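{- Let $T:\{0,1\}^*\to\{0,1\}^*$ be an aperiodic morphism. Then $T$ is either order-preserving on infinite words or order-reversing on infinite words.
   Context: A binary morphism $T$ is aperiodic if $T(0)$ and $T(1)$ are not powers of a common word. Infinite binary words are ordered lexicographically with $0<1$ ($u<v$ if $u=xay$, $v=xbz$ with letters $a<b$). $T$ is order-preserving on infinite words if for all infinite words $u\le v$ we have $T(u)\le T(v)$; it is order-reversing on infinite words if for all infinite words $u<v$ we have $T(u)>T(v)$. -}

module Defs where

open import Data.Bool using (Bool; true; false)
open import Data.Nat using (ℕ; zero; suc; _<_)
open import Data.List using (List; []; _∷_; concat; replicate; map)
open import Data.Product using (Σ; _×_)
open import Data.Sum using (_⊎_)
open import Relation.Binary.PropositionalEquality using (_≡_)
open import Relation.Nullary using (¬_)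

-- Finite binary words: lists over Bool (false = 0, true = 1).
Word : Set
Word = List Bool

InfWord : Set
InfWord = ℕ → Bool

record Morphism : Set where
  constructor morph
  field
    img0 : Word
    img1 : Word

open Morphism public

letterImg : Morphism → Bool → Word
letterImg T false = img0 T
letterImg T true  = img1 T

applyFin : Morphism → Word → Word
applyFin T w = concat (map (letterImg T) w)

_^ʷ_ : Word → ℕ → Word
w ^ʷ n = concat (replicate n w)

Aperiodic : Morphism → Set
Aperiodic T = ¬ (Σ Word λ w → Σ ℕ λ m → Σ ℕ λ n →
                   (img0 T ≡ w ^ʷ m) × (img1 T ≡ w ^ʷ n))

prefix : InfWord → ℕ → Word
prefix u zero    = []
prefix u (suc n) = prefix u n Data.List.++ (u n ∷ [])
  where import Data.List

-- Letter at a position of a finite word (default false if out of range).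
at : Word → ℕ → Bool
at []      _       = false
at (a ∷ _) zero    = a
at (_ ∷ w) (suc k) = at w k

-- Image of an infinite word: letter k of T(u) is letter k of T(u_0 … u_k).
-- When T(0), T(1) are nonempty (implied by aperiodicity) T(u_0…u_k) has
-- length ≥ k+1, so this is exactly the k-th letter of the infinite word T(u).
applyInf : Morphism → InfWord → InfWord
applyInf T u k = at (applyFin T (prefix u (suc k))) k

_<ᴵ_ : InfWord → InfWord → Set
u <ᴵ v = Σ ℕ λ n → (∀ i → i < n → u i ≡ v i) × (u n ≡ false) × (v n ≡ true)

_≤ᴵ_ : InfWord → InfWord → Set
u ≤ᴵ v = (u <ᴵ v) ⊎ (∀ i → u i ≡ v i)

OrderPreserving : Morphism → Set
OrderPreserving T = ∀ (u v : InfWord) → u ≤ᴵ v → applyInf T u ≤ᴵ applyInf T v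

OrderReversing : Morphism → Set
OrderReversing T = ∀ (u v : InfWord) → u <ᴵ v → applyInf T v <ᴵ applyInf T u

module Submission where

-- Write x = T 0 and y = T 1 (both nonempty by aperiodicity). Unless x and y are powers of a
-- common word, there are a position n and letters a ≠ b such that x · P and y · Q first differ
-- at n, reading a and b there, for all long enough P, Q ∈ {x, y}*. This follows by a Euclid-style
-- descent: if y = x · r, a separation of (x, r) yields one of (x, y) shifted by |x|, since every
-- long word of {x, y}* starts with x. Now if u < v first differ at m, then T u and T v share
-- T (u₀ … u_{m-1}) and continue as x · P and y · Q, so they first differ by a against b. As a and
-- b do not depend on u and v, T preserves the order if (a , b) = (0 , 1) and reverses it otherwise.

open import Defs
open import Data.Bool using (Bool; true; false)
open import Data.Bool.Properties using () renaming (_≟_ to _≟ᴮ_)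
open import Data.Empty using (⊥-elim)
open import Data.List using ([]; _∷_; _++_; length; concat; map)
open import Data.List.Properties using (++-assoc; ++-identityʳ; length-++; map-++; concat-++)
open import Data.Nat using (ℕ; zero; suc; _+_; _∸_; _≤_; _<_; z≤n; s≤s)
open import Data.Nat.Properties
open import Data.Product using (Σ; _×_; _,_; map₂)
open import Data.Sum using (_⊎_; inj₁; inj₂)
open import Relation.Nullary using (¬_; yes; no)
open import Relation.Binary.PropositionalEquality
open ≡-Reasoning

DiffersAt : InfWord → InfWord → ℕ → Bool → Bool → Set
DiffersAt u v n a b = (∀ i → i < n → u i ≡ v i) × u n ≡ a × v n ≡ b

DiffersAt-swap : ∀ {u v n a b} → DiffersAt u v n a b → DiffersAt v u n b a
DiffersAt-swap (agree , ua , vb) = (λ i i<n → sym (agree i i<n)) , vb , ua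

DiffersAt-cong : ∀ {u u′ v v′ n a b} →
                 (∀ i → i ≤ n → u i ≡ u′ i) → (∀ i → i ≤ n → v i ≡ v′ i) →
                 DiffersAt u′ v′ n a b → DiffersAt u v n a b
DiffersAt-cong u≈ v≈ (agree , ua , vb) =
  (λ i i<n → trans (u≈ i (<⇒≤ i<n)) (trans (agree i i<n) (sym (v≈ i (<⇒≤ i<n))))) ,
  trans (u≈ _ ≤-refl) ua ,
  trans (v≈ _ ≤-refl) vb

DiffersAt-∷ : ∀ h {A B n a b} → DiffersAt (at A) (at B) n a b →
              DiffersAt (at (h ∷ A)) (at (h ∷ B)) (suc n) a b
DiffersAt-∷ h (agree , ua , vb) = (λ { zero _ → refl ; (suc i) (s≤s i<n) → agree i i<n }) , ua , vb

DiffersAt-++ˡ : ∀ c {A B n a b} → DiffersAt (at A) (at B) n a b →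
                DiffersAt (at (c ++ A)) (at (c ++ B)) (length c + n) a b
DiffersAt-++ˡ []      d = d
DiffersAt-++ˡ (h ∷ c) d = DiffersAt-∷ h (DiffersAt-++ˡ c d)

data Comparison : Word → Word → Set where
  prefixˡ  : ∀ {x} r → Comparison x (x ++ r)
  prefixʳ  : ∀ {y} r → Comparison (y ++ r) y
  mismatch : ∀ {x y} n a b → ¬ a ≡ b →
             (∀ P Q → DiffersAt (at (x ++ P)) (at (y ++ Q)) n a b) → Comparison x y

comparison : ∀ x y → Comparison x y
comparison []      y       = prefixˡ y
comparison (h ∷ x) []      = prefixʳ (h ∷ x)
comparison (h ∷ x) (g ∷ y) with h ≟ᴮ g
... | no h≢g = mismatch 0 h g h≢g (λ _ _ → (λ _ ()) , refl , refl)
... | yes refl with comparison x y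
...   | prefixˡ r              = prefixˡ r
...   | prefixʳ r              = prefixʳ r
...   | mismatch n a b a≢b d = mismatch (suc n) a b a≢b (λ P Q → DiffersAt-∷ h (d P Q))

data Factors (x y : Word) : Word → Set where
  nil  : Factors x y []
  x++_ : ∀ {w} → Factors x y w → Factors x y (x ++ w)
  y++_ : ∀ {w} → Factors x y w → Factors x y (y ++ w)

Factors-swap : ∀ {x y w} → Factors x y w → Factors y x w
Factors-swap nil      = nil
Factors-swap (x++ c) = y++ Factors-swap c
Factors-swap (y++ c) = x++ Factors-swap c

Factors-refine : ∀ {x r w} → Factors x (x ++ r) w → Factors x r w
Factors-refine nil = nil
Factors-refine (x++ c) = x++ Factors-refine c
Factors-refine {x} {r} (y++_ {w} c) =
  subst (Factors x r) (sym (++-assoc x r w)) (x++ (y++ Factors-refine c))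

Factors-peel : ∀ {x r P} → Factors x (x ++ r) P → 0 < length P →
               Σ Word λ P′ → P ≡ x ++ P′ × Factors x r P′
Factors-peel nil ()
Factors-peel (x++_ {w} c) _ = w , refl , Factors-refine c
Factors-peel {x} {r} (y++_ {w} c) _ = r ++ w , ++-assoc x r w , y++ Factors-refine c

PowersOfCommonWord : Word → Word → Set
PowersOfCommonWord x y = Σ Word λ w → Σ ℕ λ m → Σ ℕ λ n → (x ≡ w ^ʷ m) × (y ≡ w ^ʷ n)

^ʷ-+ : ∀ w m n → w ^ʷ (m + n) ≡ w ^ʷ m ++ w ^ʷ n
^ʷ-+ w zero    n = refl
^ʷ-+ w (suc m) n = trans (cong (w ++_) (^ʷ-+ w m n)) (sym (++-assoc w (w ^ʷ m) (w ^ʷ n)))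

PowersOfCommonWord-[]ˡ : ∀ y → PowersOfCommonWord [] y
PowersOfCommonWord-[]ˡ y = y , 0 , 1 , refl , sym (++-identityʳ y)

PowersOfCommonWord-swap : ∀ {x y} → PowersOfCommonWord x y → PowersOfCommonWord y x
PowersOfCommonWord-swap (w , m , n , x≡ , y≡) = w , n , m , y≡ , x≡

SeparatedBy : Word → Word → ℕ → Bool → Bool → Set
SeparatedBy x y n a b = ∀ {P Q} → Factors x y P → Factors x y Q →
                        length y ≤ length P → length x ≤ length Q →
                        DiffersAt (at (x ++ P)) (at (y ++ Q)) n a b

Separated : Word → Word → Set
Separated x y = Σ ℕ λ n → Σ Bool λ a → Σ Bool λ b → ¬ a ≡ b × SeparatedBy x y n a b

Separated-swap : ∀ {x y} → Separated x y → Separated y x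
Separated-swap (n , a , b , a≢b , sep) =
  n , b , a , (λ b≡a → a≢b (sym b≡a)) ,
  λ cP cQ lP lQ → DiffersAt-swap (sep (Factors-swap cQ) (Factors-swap cP) lQ lP)

Dichotomy : Word → Word → Set
Dichotomy x y = PowersOfCommonWord x y ⊎ Separated x y

Dichotomy-swap : ∀ {x y} → Dichotomy x y → Dichotomy y x
Dichotomy-swap (inj₁ powers)    = inj₁ (PowersOfCommonWord-swap powers)
Dichotomy-swap (inj₂ separated) = inj₂ (Separated-swap separated)

length-++-cancelˡ-≤ : ∀ x {r s : Word} → length (x ++ r) ≤ length (x ++ s) → length r ≤ length s
length-++-cancelˡ-≤ x le = +-cancelˡ-≤ (length x) _ _ (subst₂ _≤_ (length-++ x) (length-++ x) le)

Dichotomy-extend : ∀ x {r} → Dichotomy x r → Dichotomy x (x ++ r)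
Dichotomy-extend [] d = d
Dichotomy-extend x (inj₁ (w , m , n , x≡ , r≡)) =
  inj₁ (w , m , m + n , x≡ , trans (cong₂ _++_ x≡ r≡) (sym (^ʷ-+ w m n)))
Dichotomy-extend x@(_ ∷ _) {r} (inj₂ (n , a , b , a≢b , sep)) = inj₂ (length x + n , a , b , a≢b , sep′)
  where
  sep′ : SeparatedBy x (x ++ r) (length x + n) a b
  sep′ {Q = Q} cP cQ lP lQ with Factors-peel cP (≤-trans (s≤s z≤n) lP)
  ... | P′ , refl , cP′ =
    subst (λ W → DiffersAt (at (x ++ (x ++ P′))) (at W) (length x + n) a b) (sym (++-assoc x r Q))
      (DiffersAt-++ˡ x (sep cP′ (Factors-refine cQ) (length-++-cancelˡ-≤ x lP) lQ))

dichotomy : ∀ x y → Dichotomy x y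
dichotomy x y = bounded (length x + length y) x y ≤-refl
  where
  shrinks : ∀ x r {k} → 0 < length x → length x + length (x ++ r) ≤ suc k → length x + length r ≤ k
  shrinks x r 0<x le = ≤-pred (≤-trans (+-monoʳ-< (length x) r<xr) le)
    where
    r<xr : length r < length (x ++ r)
    r<xr = subst (length r <_) (sym (length-++ x)) (m<n+m (length r) 0<x)

  bounded : ∀ k x y → length x + length y ≤ k → Dichotomy x y
  bounded _ [] y _ = inj₁ (PowersOfCommonWord-[]ˡ y)
  bounded _ x [] _ = Dichotomy-swap (inj₁ (PowersOfCommonWord-[]ˡ x))
  bounded zero (_ ∷ _) (_ ∷ _) ()
  bounded (suc k) (h ∷ x) (g ∷ y) le with comparison (h ∷ x) (g ∷ y)
  ... | prefixˡ r = Dichotomy-extend (h ∷ x) (bounded k (h ∷ x) r (shrinks (h ∷ x) r (s≤s z≤n) le))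
  ... | prefixʳ r = Dichotomy-swap (Dichotomy-extend (g ∷ y) (Dichotomy-swap (bounded k r (g ∷ y) r+y≤k)))
    where
    r+y≤k : length r + length (g ∷ y) ≤ k
    r+y≤k = subst (_≤ k) (+-comm (length (g ∷ y)) (length r))
              (shrinks (g ∷ y) r (s≤s z≤n) (subst (_≤ suc k) (+-comm _ (length (g ∷ y))) le))
  ... | mismatch n a b a≢b d = inj₂ (n , a , b , a≢b , λ _ _ _ _ → d _ _)

NonErasing : Morphism → Set
NonErasing T = ∀ c → 0 < length (letterImg T c)

aperiodic⇒nonErasing : ∀ T → Aperiodic T → NonErasing T
aperiodic⇒nonErasing (morph [] y)      aperiodic false = ⊥-elim (aperiodic (PowersOfCommonWord-[]ˡ y))
aperiodic⇒nonErasing (morph (_ ∷ _) _) _         false = s≤s z≤n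
aperiodic⇒nonErasing (morph x [])      aperiodic true  =
  ⊥-elim (aperiodic (PowersOfCommonWord-swap (PowersOfCommonWord-[]ˡ x)))
aperiodic⇒nonErasing (morph _ (_ ∷ _)) _         true  = s≤s z≤n

applyFin-++ : ∀ T w w′ → applyFin T (w ++ w′) ≡ applyFin T w ++ applyFin T w′
applyFin-++ T w w′ = trans (cong concat (map-++ (letterImg T) w w′)) (sym (concat-++ (map (letterImg T) w) (map (letterImg T) w′)))

applyFin-factors : ∀ T w → Factors (img0 T) (img1 T) (applyFin T w)
applyFin-factors T []          = nil
applyFin-factors T (false ∷ w) = x++ applyFin-factors T w
applyFin-factors T (true ∷ w)  = y++ applyFin-factors T w

length-applyFin : ∀ {T} → NonErasing T → ∀ w → length w ≤ length (applyFin T w)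
length-applyFin     nonErasing []      = z≤n
length-applyFin {T} nonErasing (c ∷ w) =
  subst (suc (length w) ≤_) (sym (length-++ (letterImg T c)))
    (+-mono-≤ (nonErasing c) (length-applyFin nonErasing w))

slice : InfWord → ℕ → ℕ → Word
slice u s zero    = []
slice u s (suc K) = u s ∷ slice u (suc s) K

length-slice : ∀ u s K → length (slice u s K) ≡ K
length-slice u s zero    = refl
length-slice u s (suc K) = cong suc (length-slice u (suc s) K)

prefix-++-slice : ∀ u s K → prefix u (s + K) ≡ prefix u s ++ slice u s K
prefix-++-slice u s zero rewrite +-identityʳ s = sym (++-identityʳ (prefix u s))
prefix-++-slice u s (suc K) rewrite +-suc s K =
  trans (prefix-++-slice u (suc s) K) (++-assoc (prefix u s) (u s ∷ []) (slice u (suc s) K))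

length-prefix : ∀ u M → length (prefix u M) ≡ M
length-prefix u zero    = refl
length-prefix u (suc M) =
  trans (length-++ (prefix u M)) (trans (cong (_+ 1) (length-prefix u M)) (+-comm M 1))

prefix-cong : ∀ u v M → (∀ i → i < M → u i ≡ v i) → prefix u M ≡ prefix v M
prefix-cong u v zero    _     = refl
prefix-cong u v (suc M) agree =
  cong₂ _++_ (prefix-cong u v M (λ i i<M → agree i (m<n⇒m<1+n i<M))) (cong (_∷ []) (agree M ≤-refl))

applyInf-cong : ∀ T {u v} → (∀ i → u i ≡ v i) → ∀ k → applyInf T u k ≡ applyInf T v k
applyInf-cong T {u} {v} u≗v k =
  cong (λ w → at (applyFin T w) k) (prefix-cong u v (suc k) (λ i _ → u≗v i))

at-++ˡ : ∀ (A B : Word) {k} → k < length A → at (A ++ B) k ≡ at A k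
at-++ˡ (a ∷ A) B {zero}  _         = refl
at-++ˡ (a ∷ A) B {suc k} (s≤s k<A) = at-++ˡ A B k<A

at-applyFin-prefix-≤ : ∀ T u {M M′ k} → M ≤ M′ → k < length (applyFin T (prefix u M)) →
                       at (applyFin T (prefix u M′)) k ≡ at (applyFin T (prefix u M)) k
at-applyFin-prefix-≤ T u {M} {M′} {k} M≤M′ k< = begin
    at (applyFin T (prefix u M′)) k
  ≡⟨ cong (λ N → at (applyFin T (prefix u N)) k) (sym (m+[n∸m]≡n M≤M′)) ⟩
    at (applyFin T (prefix u (M + (M′ ∸ M)))) k
  ≡⟨ cong (λ w → at (applyFin T w) k) (prefix-++-slice u M (M′ ∸ M)) ⟩
    at (applyFin T (prefix u M ++ slice u M (M′ ∸ M))) k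
  ≡⟨ cong (λ w → at w k) (applyFin-++ T (prefix u M) (slice u M (M′ ∸ M))) ⟩
    at (applyFin T (prefix u M) ++ applyFin T (slice u M (M′ ∸ M))) k
  ≡⟨ at-++ˡ (applyFin T (prefix u M)) _ k< ⟩
    at (applyFin T (prefix u M)) k
  ∎

applyInf-prefix : ∀ {T} → NonErasing T → ∀ u {M k} → k < length (applyFin T (prefix u M)) →
                  applyInf T u k ≡ at (applyFin T (prefix u M)) k
applyInf-prefix {T} nonErasing u {M} {k} k< with ≤-total M (suc k)
... | inj₁ M≤1+k = at-applyFin-prefix-≤ T u M≤1+k k<
... | inj₂ 1+k≤M = sym (at-applyFin-prefix-≤ T u 1+k≤M k<image)
  where
  k<image : k < length (applyFin T (prefix u (suc k)))
  k<image = ≤-trans (≤-reflexive (sym (length-prefix u (suc k)))) (length-applyFin nonErasing (prefix u (suc k)))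

length-applyFin-slice : ∀ {T} → NonErasing T → ∀ u s K → K ≤ length (applyFin T (slice u s K))
length-applyFin-slice {T} nonErasing u s K =
  subst (_≤ length (applyFin T (slice u s K))) (length-slice u s K) (length-applyFin nonErasing (slice u s K))

applyInf-image : ∀ {T} → NonErasing T → ∀ u m K {X c n} →
                 applyFin T (prefix u m) ≡ X → u m ≡ c → n ≤ K →
                 ∀ j → j ≤ length X + n →
                 applyInf T u j ≡ at (X ++ (letterImg T c ++ applyFin T (slice u (suc m) K))) j
applyInf-image {T} nonErasing u m K {n = n} refl refl n≤K j j≤ = begin
    applyInf T u j
  ≡⟨ applyInf-prefix nonErasing u {m + suc K} (subst (λ w → j < length w) (sym image) j<) ⟩
    at (applyFin T (prefix u (m + suc K))) j
  ≡⟨ cong (λ w → at w j) image ⟩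
    at (X ++ (z ++ R)) j
  ∎
  where
  X = applyFin T (prefix u m)
  z = letterImg T (u m)
  R = applyFin T (slice u (suc m) K)
  image : applyFin T (prefix u (m + suc K)) ≡ X ++ (z ++ R)
  image = trans (cong (applyFin T) (prefix-++-slice u m (suc K))) (applyFin-++ T (prefix u m) (slice u m (suc K)))
  R<zR : length R < length (z ++ R)
  R<zR = subst (length R <_) (sym (length-++ z)) (m<n+m (length R) (nonErasing (u m)))
  j< : j < length (X ++ (z ++ R))
  j< = ≤-<-trans j≤ (subst (length X + n <_) (sym (length-++ X))
         (+-monoʳ-< (length X) (≤-<-trans (≤-trans n≤K (length-applyFin-slice nonErasing u (suc m) K)) R<zR)))

applyInf-DiffersAt : ∀ {T} → NonErasing T → ∀ {n a b} → SeparatedBy (img0 T) (img1 T) n a b →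
                     ∀ {u v} → u <ᴵ v → Σ ℕ λ N → DiffersAt (applyInf T u) (applyInf T v) N a b
applyInf-DiffersAt {T} nonErasing {n} sep {u} {v} (m , agree , u≡0 , v≡1) =
  length X + n ,
  DiffersAt-cong (applyInf-image nonErasing u m K refl u≡0 n≤K)
                 (applyInf-image nonErasing v m K v-shares-X v≡1 n≤K)
                 (DiffersAt-++ˡ X (sep (applyFin-factors T (slice u (suc m) K)) (applyFin-factors T (slice v (suc m) K))
                   (≤-trans y≤K (length-applyFin-slice nonErasing u (suc m) K))
                   (≤-trans x≤K (length-applyFin-slice nonErasing v (suc m) K))))
  where
  K = length (img0 T) + length (img1 T) + n
  X = applyFin T (prefix u m)
  v-shares-X : applyFin T (prefix v m) ≡ X
  v-shares-X = cong (applyFin T) (sym (prefix-cong u v m agree))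
  n≤K : n ≤ K
  n≤K = m≤n+m n _
  x≤K : length (img0 T) ≤ K
  x≤K = ≤-trans (m≤m+n _ _) (m≤m+n _ n)
  y≤K : length (img1 T) ≤ K
  y≤K = ≤-trans (m≤n+m _ (length (img0 T))) (m≤m+n _ n)

theorem20 : (T : Morphism) → Aperiodic T → OrderPreserving T ⊎ OrderReversing T
theorem20 T aperiodic = fromDichotomy (dichotomy (img0 T) (img1 T))
  where
  nonErasing : NonErasing T
  nonErasing = aperiodic⇒nonErasing T aperiodic

  fromDichotomy : Dichotomy (img0 T) (img1 T) → OrderPreserving T ⊎ OrderReversing T
  fromDichotomy (inj₁ powers) = ⊥-elim (aperiodic powers)
  fromDichotomy (inj₂ (_ , false , true , _ , sep)) = inj₁ λ where
    u v (inj₁ u<v) → inj₁ (applyInf-DiffersAt nonErasing sep u<v)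
    u v (inj₂ u≗v) → inj₂ (applyInf-cong T u≗v)
  fromDichotomy (inj₂ (_ , true , false , _ , sep)) =
    inj₂ λ u v u<v → map₂ DiffersAt-swap (applyInf-DiffersAt nonErasing sep u<v)
  fromDichotomy (inj₂ (_ , false , false , a≢b , _)) = ⊥-elim (a≢b refl)
  fromDichotomy (inj₂ (_ , true  , true  , a≢b , _)) = ⊥-elim (a≢b refl)
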